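{- Let $\Gamma$ be a chain of cycles of genus $g\geq 2$ with torsion profile $\underline{m}=(m_2,\dots,m_g)$. Let $r\in\mathbb{Z}_{\geq 1}$ and $d\in\mathbb{Z}$ with $r-d+g\geq 2$ and $d\geq g$. If there exists an $\underline{m}$-displacement tableau $t:[(g-d+r)\times(r+1)]\to\{1,\dots,g\}$, then there exists an $\underline{m}$-displacement tableau $t':[(g-d+2r-1)\times 2]\to\{1,\dots,g\}$.
   Context: A chain of cycles of genus $g$ is the metric graph constructed as follows: take $g$ metric graphs $C_1,\dots,C_g$, each isometric to a circle; on each $C_i$ choose two distinct points $v_i,w_i$; for $1\leq i\leq g-1$ connect $w_i$ and $v_{i+1}$ by a line segment. Its torsion profile $\underline{m}=(m_2,\dots,m_g)$ is defined by: letting $l_i$ be the length of $C_i$ and $l(v_i,w_i)$ the length of the clockwise arc on $C_i$ from $v_i$ to $w_i$, $m_i=0$ if $l_i$ is an irrational multiple of $l(v_i,w_i)$, and otherwise $m_i$ is the minimal positive integer such that $m_i\,l(v_i,w_i)$ is an integer multiple of $l_i$. For positive integers $a,b$, $[a\times b]$ denotes $\{1,\dots,a\}\times\{1,\dots,b\}$. An $\underline{m}$-displacement tableau on $[a\times b]$ is a function $t:[a\times b]\to\{1,\dots,g\}$ such that (i) $t$ is strictly increasing in each coordinate when the other coordinate is fixed, and (ii) if $t(x,y)=t(x',y')$ then $x-y\equiv x'-y' \pmod{m_{t(x,y)}}$ (congruence modulo $0$ meaning equality; the condition is vacuous for the value $1$, which can only occur at $(1,1)$). -}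

module Defs where

open import Data.Nat using (ℕ; _≤_; _<_)
open import Data.Integer as ℤ using (ℤ; +_; _-_)
open import Data.Integer.Divisibility using (_∣_)
open import Data.Product using (_×_)
open import Relation.Nullary using (¬_)
open import Relation.Binary.PropositionalEquality using (_≡_)

-- Since v_i ≠ w_i, the arc
-- length l(v_i,w_i) lies strictly between 0 and l_i, so m_i ≠ 1; conversely
-- every sequence with entries in {0,2,3,...} is the torsion profile of some chain.
TorsionProfile : ℕ → (ℕ → ℕ) → Set
TorsionProfile g m = ∀ i → 2 ≤ i → i ≤ g → ¬ (m i ≡ 1)

InBox : ℕ → ℕ → ℕ → ℕ → Set
InBox a b x y = (1 ≤ x × x ≤ a) × (1 ≤ y × y ≤ b)

-- congruence x - y ≡ x' - y' (mod n), in ℤ; modulo 0 means equality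
-- (in the stdlib, (+ 0) ∣ k iff k ≡ 0).
DiagCongr : ℕ → ℕ → ℕ → ℕ → ℕ → Set
DiagCongr n x y x' y' = (+ n) ∣ ((+ x - + y) - (+ x' - + y'))

-- An m-displacement tableau on [a × b] with values in {1,…,g}
-- (t is a function on ℕ × ℕ; only its values on [a × b] matter).
record DisplacementTableau (g : ℕ) (m : ℕ → ℕ) (a b : ℕ) : Set where
  field
    t       : ℕ → ℕ → ℕ
    range   : ∀ x y → InBox a b x y → 1 ≤ t x y × t x y ≤ g
    incr₁   : ∀ x x' y → InBox a b x y → InBox a b x' y → x < x' → t x y < t x' y
    incr₂   : ∀ x y y' → InBox a b x y → InBox a b x y' → y < y' → t x y < t x y'
    displ   : ∀ x y x' y' → InBox a b x y → InBox a b x' y' →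
              t x y ≡ t x' y' → DiagCongr (m (t x y)) x y x' y'

-- Put a = g - d + r - 1 and b = r, so that t lives on [(a+1) × (b+1)] and the
-- wanted tableau on [(a+b) × 2].  Its two columns are read off along a lattice
-- path P₁, …, P_{a+b} from (1,1) to (a, b+1) that moves right or down, the
-- second column along the translate Q_x = P_{x+1} + (1,-1).  All comparisons
-- needed then hold because the cells compared are comparable in [(a+1) × (b+1)],
-- except at a down step of P, where t(P_x) < t(P_x + (2,-1)) has to be asked for;
-- and equal entries in different columns can only come from P and Q on a common
-- row, where the diagonals match.  The greedy path, which descends whenever it
-- is allowed to, either reaches row a in time, or it is stuck right of the box;
-- then its translate by (2,-1), clamped to the box, is such a path for the
-- transposed tableau, since at each greedy right step from a cell c inside the
-- box, t(c + (2,-1)) ≤ t(c) < t(c + (1,1)).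
module Submission where

module TwoColumns where

  open import Defs
  open import Data.Nat
  open import Data.Nat.Properties
  open import Data.Nat.Divisibility using (_∣_; _∣0)
  open import Data.Integer.Base as ℤ using (+_; _⊖_)
  import Data.Integer.Properties as ℤ
  open import Data.Integer.Tactic.RingSolver using (solve-∀)
  open import Data.Product using (_×_; _,_; proj₁; proj₂; ∃-syntax)
  open import Data.Sum using (_⊎_; inj₁; inj₂)
  open import Function using (_∘_)
  open import Relation.Nullary using (¬_; Dec; yes; no; contradiction)
  open import Relation.Nullary.Decidable using (_×-dec_)
  open import Relation.Binary using (_Preserves_⟶_)
  open import Relation.Binary.Definitions using (tri<; tri≈; tri>)
  open import Relation.Binary.PropositionalEquality

  variable
    g n n' a b c u x y x' y' : ℕ
    m : ℕ → ℕ
    P : ℕ → Set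

  diagonal-difference : ∀ x y x' y' →
                        (+ x ℤ.- + y) ℤ.- (+ x' ℤ.- + y') ≡ (x + y') ⊖ (x' + y)
  diagonal-difference x y x' y' = begin
    (+ x ℤ.- + y) ℤ.- (+ x' ℤ.- + y')  ≡⟨ rearrange (+ x) (+ y) (+ x') (+ y') ⟩
    (+ x ℤ.+ + y') ℤ.- (+ x' ℤ.+ + y)  ≡⟨ cong₂ ℤ._-_ (ℤ.pos-+ x y') (ℤ.pos-+ x' y) ⟨
    + (x + y') ℤ.- + (x' + y)          ≡⟨ ℤ.[+m]-[+n]≡m⊖n (x + y') (x' + y) ⟩
    (x + y') ⊖ (x' + y)                ∎
    where
      open ≡-Reasoning
      rearrange : ∀ i j i' j' → (i ℤ.- j) ℤ.- (i' ℤ.- j') ≡ (i ℤ.+ j') ℤ.- (i' ℤ.+ j)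
      rearrange = solve-∀

  DiagCongr⇒∣⊖∣ : ∀ {n} x y x' y' → DiagCongr n x y x' y' → n ∣ ℤ.∣ (x + y') ⊖ (x' + y) ∣
  DiagCongr⇒∣⊖∣ {n} x y x' y' =
    subst (λ z → n ∣ ℤ.∣ z ∣) (diagonal-difference x y x' y')

  ∣⊖∣⇒DiagCongr : ∀ {n} x y x' y' → n ∣ ℤ.∣ (x + y') ⊖ (x' + y) ∣ → DiagCongr n x y x' y'
  ∣⊖∣⇒DiagCongr {n} x y x' y' =
    subst (λ z → n ∣ ℤ.∣ z ∣) (sym (diagonal-difference x y x' y'))

  DiagCongr-refl : ∀ n x y → DiagCongr n x y x y
  DiagCongr-refl n x y =
    ∣⊖∣⇒DiagCongr x y x y (subst (λ z → n ∣ ℤ.∣ z ∣) (sym (ℤ.n⊖n≡0 (x + y))) (n ∣0))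

  DiagCongr-cross : ∀ {n} x y x' y' p q p' q' → x + y' ≡ p' + q → x' + y ≡ p + q' →
                    DiagCongr n x y x' y' → DiagCongr n p q p' q'
  DiagCongr-cross {n} x y x' y' p q p' q' e e' =
    ∣⊖∣⇒DiagCongr p q p' q' ∘ subst₂ (λ i j → n ∣ ℤ.∣ i ⊖ j ∣) e' e ∘
    subst (n ∣_) (ℤ.∣m⊖n∣≡∣n⊖m∣ (x + y') (x' + y)) ∘ DiagCongr⇒∣⊖∣ x y x' y'

  module _ (T : DisplacementTableau g m a b) where
    open DisplacementTableau T

    entry-< : InBox a b x y → InBox a b x' y' → x ≤ x' → y ≤ y' → x + y < x' + y' →
              t x y < t x' y'
    entry-< {x} {y} {x'} {y'} box box' x≤x' y≤y' diagonal<
      with m≤n⇒m<n∨m≡n x≤x' | m≤n⇒m<n∨m≡n y≤y'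
    ... | inj₁ x<x' | inj₁ y<y' =
      <-trans (incr₁ x x' y box corner x<x') (incr₂ x' y y' corner box' y<y')
      where corner = proj₁ box' , proj₂ box
    ... | inj₁ x<x' | inj₂ refl = incr₁ x x' y box box' x<x'
    ... | inj₂ refl | inj₁ y<y' = incr₂ x y y' box box' y<y'
    ... | inj₂ refl | inj₂ refl = contradiction refl (<⇒≢ diagonal<)

  transpose : DisplacementTableau g m a b → DisplacementTableau g m b a
  transpose T = record
    { t     = λ x y → t y x
    ; range = λ x y → range y x ∘ swap
    ; incr₁ = λ x x' y box box' → incr₂ y x x' (swap box) (swap box')
    ; incr₂ = λ x y y' box box' → incr₁ y y' x (swap box) (swap box')
    ; displ = λ x y x' y' box box' e →
                DiagCongr-cross y x y' x' x y x' y' (+-comm y x') (+-comm y' x)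
                  (displ y x y' x' (swap box) (swap box') e)
    }
    where
      open DisplacementTableau T
      swap : InBox b a x y → InBox a b y x
      swap (row , column) = column , row

  strictMono⇒injective : (f : ℕ → ℕ) → (∀ {x x'} → P x → P x' → x < x' → f x < f x') →
                         P x → P x' → f x ≡ f x' → x ≡ x'
  strictMono⇒injective {x = x} {x'} f mono px px' e with <-cmp x x'
  ... | tri< x<x' _ _ = contradiction e (<⇒≢ (mono px px' x<x'))
  ... | tri≈ _ x≡x' _ = x≡x'
  ... | tri> _ _ x'<x = contradiction (sym e) (<⇒≢ (mono px' px x'<x))

  Step : ℕ → ℕ → Set
  Step n n' = n' ≡ n ⊎ n' ≡ suc n

  Step⇒≤ : Step n n' → n ≤ n'
  Step⇒≤ (inj₁ refl) = ≤-refl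
  Step⇒≤ (inj₂ refl) = n≤1+n _

  Step⇒≤suc : Step n n' → n' ≤ suc n
  Step⇒≤suc (inj₁ refl) = n≤1+n _
  Step⇒≤suc (inj₂ refl) = ≤-refl

  Step⇒mono : (f : ℕ → ℕ) → (∀ x → Step (f x) (f (suc x))) → f Preserves _≤_ ⟶ _≤_
  Step⇒mono f step {y = zero} z≤n = ≤-refl
  Step⇒mono f step {x} {suc y} x≤1+y with m≤n⇒m<n∨m≡n x≤1+y
  ... | inj₁ x<1+y = ≤-trans (Step⇒mono f step (≤-pred x<1+y)) (Step⇒≤ (step y))
  ... | inj₂ refl = ≤-refl

  suc-Step : Step n n' → Step (suc n) (suc n')
  suc-Step (inj₁ e) = inj₁ (cong suc e)
  suc-Step (inj₂ e) = inj₂ (cong suc e)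

  ∸-Step : ∀ k → Step n n' → Step (n ∸ k) (n' ∸ k)
  ∸-Step k (inj₁ refl) = inj₁ refl
  ∸-Step k (inj₂ refl) = suc-∸ _ k
    where
      suc-∸ : ∀ n k → Step (n ∸ k) (suc n ∸ k)
      suc-∸ n       zero    = inj₂ refl
      suc-∸ zero    (suc k) = inj₁ (0∸n≡0 k)
      suc-∸ (suc n) (suc k) = suc-∸ n k

  ⊓-Step : ∀ c → Step n n' → Step (n ⊓ c) (n' ⊓ c)
  ⊓-Step c (inj₁ refl) = inj₁ refl
  ⊓-Step c (inj₂ refl) = suc-⊓ _ c
    where
      suc-⊓ : ∀ n c → Step (n ⊓ c) (suc n ⊓ c)
      suc-⊓ n       zero    = inj₁ (sym (⊓-zeroʳ n))
      suc-⊓ zero    (suc c) = inj₂ refl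
      suc-⊓ (suc n) (suc c) = suc-Step (suc-⊓ n c)

  suc-⊓-increase⇒< : ∀ n c → suc n ⊓ c ≡ suc (n ⊓ c) → n < c
  suc-⊓-increase⇒< n       zero    ()
  suc-⊓-increase⇒< zero    (suc c) _ = s≤s z≤n
  suc-⊓-increase⇒< (suc n) (suc c) e = s≤s (suc-⊓-increase⇒< n c (suc-injective e))

  clamp : ℕ → ℕ → ℕ
  clamp c n = suc ((n ∸ 2) ⊓ c)

  clamp-Step : ∀ c → Step n n' → Step (clamp c n) (clamp c n')
  clamp-Step c = suc-Step ∘ ⊓-Step c ∘ ∸-Step 2

  clamp-≤ : ∀ c n → clamp c n ≤ suc c
  clamp-≤ c n = s≤s (m⊓n≤n (n ∸ 2) c)

  clamp-≤-suc-pred : ∀ c n → clamp c n ≤ suc (pred n)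
  clamp-≤-suc-pred c zero          = ≤-refl
  clamp-≤-suc-pred c (suc zero)    = ≤-refl
  clamp-≤-suc-pred c (suc (suc n)) = s≤s (≤-trans (m⊓n≤m n c) (n≤1+n n))

  clamp-top : suc (suc c) ≤ n → clamp c n ≡ suc c
  clamp-top {c} 2+c≤n = cong suc (m≥n⇒m⊓n≡n (∸-monoˡ-≤ 2 2+c≤n))

  clamp-increase : ∀ c {n n'} → Step n n' → clamp c n' ≡ suc (clamp c n) →
                   ∃[ u ] n ≡ 2 + u × n' ≡ 3 + u × u < c
  clamp-increase c (inj₁ refl) e = contradiction (sym e) 1+n≢n
  clamp-increase c {zero}        (inj₂ refl) ()
  clamp-increase c {suc zero}    (inj₂ refl) ()
  clamp-increase c {suc (suc u)} (inj₂ refl) e =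
    u , refl , refl , suc-⊓-increase⇒< u c (suc-injective e)

  record Walk : Set where
    field
      row col  : ℕ → ℕ
      row+col  : ∀ x → row x + col x ≡ suc x
      row-step : ∀ x → Step (row x) (row (suc x))

    col-unique : ∀ {x r c} → row x ≡ r → r + c ≡ suc x → col x ≡ c
    col-unique {x} {r} e e' =
      +-cancelˡ-≡ r _ _ (trans (cong (_+ col x) (sym e)) (trans (row+col x) (sym e')))

    col-advance : ∀ x → row (suc x) ≡ row x → col (suc x) ≡ suc (col x)
    col-advance x e = col-unique e (trans (+-suc (row x) (col x)) (cong suc (row+col x)))

    col-descend : ∀ x → row (suc x) ≡ suc (row x) → col (suc x) ≡ col x
    col-descend x e = col-unique e (cong suc (row+col x))

    col-step : ∀ x → Step (col x) (col (suc x))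
    col-step x with row-step x
    ... | inj₁ e = inj₂ (col-advance x e)
    ... | inj₂ e = inj₁ (col-descend x e)

    row-mono : row Preserves _≤_ ⟶ _≤_
    row-mono = Step⇒mono row row-step

    col-mono : col Preserves _≤_ ⟶ _≤_
    col-mono = Step⇒mono col col-step

    col-≤ : ∀ x → col x ≤ suc x
    col-≤ x = subst (col x ≤_) (row+col x) (m≤n+m (col x) (row x))

  record Path (a b : ℕ) (t : ℕ → ℕ → ℕ) : Set where
    field
      walk : Walk
    open Walk walk public
    field
      row-1   : row 1 ≡ 1
      row-2   : row 2 ≡ 1
      row-≤   : ∀ x → row x ≤ a
      row-end : row (a + b) ≡ a
      descent : ∀ x → row (suc x) ≡ suc (row x) → t (row x) (col x) < t (2 + row x) (pred (col x))

  module AlongPath (T : DisplacementTableau g m (suc a) (suc b))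
                (path : Path a b (DisplacementTableau.t T)) where
    open DisplacementTableau T
    open Path path

    InRange : ℕ → Set
    InRange x = 1 ≤ x × x ≤ a + b

    entry : ℕ → ℕ → ℕ
    entry x 1 = t (row x) (col x)
    entry x _ = t (suc (row (suc x))) (pred (col (suc x)))

    col-1 : col 1 ≡ 1
    col-1 = col-unique row-1 refl

    col-2 : col 2 ≡ 2
    col-2 = col-unique row-2 refl

    col-end : col (a + b) ≡ suc b
    col-end = col-unique row-end (+-suc a b)

    cell₁ : InRange x → InBox (suc a) (suc b) (row x) (col x)
    cell₁ {x} (1≤x , x≤a+b) =
      (subst (_≤ row x) row-1 (row-mono 1≤x) , m≤n⇒m≤1+n (row-≤ x)) ,
      (subst (_≤ col x) col-1 (col-mono 1≤x) , subst (col x ≤_) col-end (col-mono x≤a+b))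

    2≤col : 1 ≤ x → 2 ≤ col (suc x)
    2≤col {x} 1≤x = subst (_≤ col (suc x)) col-2 (col-mono (s≤s 1≤x))

    cell₂ : InRange x → InBox (suc a) (suc b) (suc (row (suc x))) (pred (col (suc x)))
    cell₂ {x} (1≤x , x≤a+b) =
      (s≤s z≤n , s≤s (row-≤ (suc x))) ,
      (pred-mono-≤ (2≤col 1≤x) ,
       ≤-trans (pred-mono-≤ (Step⇒≤suc (col-step x)))
               (subst (col x ≤_) col-end (col-mono x≤a+b)))

    diagonal₂ : InRange x → suc (row (suc x)) + pred (col (suc x)) ≡ suc (suc x)
    diagonal₂ {x} (1≤x , _) = begin
      suc (row (suc x)) + pred (col (suc x))  ≡⟨ +-suc (row (suc x)) (pred (col (suc x))) ⟨
      row (suc x) + suc (pred (col (suc x)))  ≡⟨ cong (λ k → row (suc x) + k) suc-pred-col ⟩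
      row (suc x) + col (suc x)               ≡⟨ row+col (suc x) ⟩
      suc (suc x)                             ∎
      where
        open ≡-Reasoning
        suc-pred-col : suc (pred (col (suc x))) ≡ col (suc x)
        suc-pred-col = suc-pred (col (suc x)) {{>-nonZero (<-≤-trans z<s (2≤col 1≤x))}}

    first-< : InRange x → InRange x' → x < x' → entry x 1 < entry x' 1
    first-< {x} {x'} r@(1≤x , _) r'@(_ , x'≤a+b) x<x' =
      entry-< T (cell₁ (1≤x , ≤-trans (<⇒≤ x<x') x'≤a+b))
                (cell₁ r') (row-mono (<⇒≤ x<x')) (col-mono (<⇒≤ x<x'))
                (subst₂ _<_ (sym (row+col x)) (sym (row+col x')) (s≤s x<x'))

    second-< : InRange x → InRange x' → x < x' → entry x 2 < entry x' 2
    second-< r r' x<x' =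
      entry-< T (cell₂ r) (cell₂ r') (s≤s (row-mono (s≤s (<⇒≤ x<x'))))
                (pred-mono-≤ (col-mono (s≤s (<⇒≤ x<x'))))
                (subst₂ _<_ (sym (diagonal₂ r)) (sym (diagonal₂ r')) (s≤s (s≤s x<x')))

    first<second : InRange x → entry x 1 < entry x 2
    first<second {x} r with row-step x
    ... | inj₁ e =
      entry-< T (cell₁ r) (cell₂ r) (≤-trans (row-mono (n≤1+n x)) (n≤1+n _))
                (≤-reflexive (cong pred (sym (col-advance x e))))
                (subst₂ _<_ (sym (row+col x)) (sym (diagonal₂ r)) (n<1+n _))
    ... | inj₂ e =
      subst₂ (λ i j → t (row x) (col x) < t i j)
             (cong suc (sym e)) (cong pred (sym (col-descend x e))) (descent x e)

    first<second-≤ : InRange x → InRange x' → x ≤ x' → entry x 1 < entry x' 2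
    first<second-≤ r r' x≤x' with m≤n⇒m<n∨m≡n x≤x'
    ... | inj₁ x<x' = <-trans (first-< r r' x<x') (first<second r')
    ... | inj₂ refl = first<second r

    second<first : InRange x → InRange x' → x' < x → row (suc x') < row x →
                   entry x' 2 < entry x 1
    second<first {x} {x'} r r' x'<x rows< =
      entry-< T (cell₂ r') (cell₁ r) rows< (≤-trans pred[n]≤n (col-mono x'<x))
                (subst₂ _<_ (sym (diagonal₂ r')) (sym (row+col x)) (s≤s 1+x'<x))
      where
        1+x'<x : suc x' < x
        1+x'<x = ≤∧≢⇒< x'<x (λ e → <-irrefl (cong row e) rows<)

    first≡second⇒DiagCongr : InRange x → InRange x' → entry x 1 ≡ entry x' 2 →
                             DiagCongr (m (entry x 1)) x 1 x' 2
    first≡second⇒DiagCongr {x} {x'} r r' e with x ≤? x'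
    ... | yes x≤x' = contradiction e (<⇒≢ (first<second-≤ r r' x≤x'))
    ... | no x≰x' with m≤n⇒m<n∨m≡n (row-mono {suc x'} {x} (≰⇒> x≰x'))
    ...   | inj₁ rows< = contradiction (sym e) (<⇒≢ (second<first r r' (≰⇒> x≰x') rows<))
    ...   | inj₂ same-row =
      DiagCongr-cross (row x) (col x) (suc (row (suc x'))) (pred (col (suc x'))) x 1 x' 2
         crossing crossing' (displ _ _ _ _ (cell₁ r) (cell₂ r') e)
      where
        open ≡-Reasoning
        crossing : row x + pred (col (suc x')) ≡ x' + 1
        crossing = begin
          row x + pred (col (suc x'))         ≡⟨ cong (_+ pred (col (suc x'))) same-row ⟨
          row (suc x') + pred (col (suc x'))  ≡⟨ suc-injective (diagonal₂ r') ⟩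
          suc x'                              ≡⟨ +-comm 1 x' ⟩
          x' + 1                              ∎
        crossing' : suc (row (suc x')) + col x ≡ x + 2
        crossing' = begin
          suc (row (suc x') + col x)  ≡⟨ cong (λ i → suc (i + col x)) same-row ⟩
          suc (row x + col x)         ≡⟨ cong suc (row+col x) ⟩
          suc (suc x)                 ≡⟨ +-comm 2 x ⟩
          x + 2                       ∎

    data Column : ℕ → Set where
      first  : Column 1
      second : Column 2

    column : 1 ≤ y × y ≤ 2 → Column y
    column {suc zero}       _ = first
    column {suc (suc zero)} _ = second
    column {suc (suc (suc y))} (_ , s≤s (s≤s ()))

    tableau : DisplacementTableau g m (a + b) 2
    tableau = record
      { t = entry ; range = range′ ; incr₁ = incr₁′ ; incr₂ = incr₂′ ; displ = displ′ }
      where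
        range′ : ∀ x y → InBox (a + b) 2 x y → 1 ≤ entry x y × entry x y ≤ g
        range′ x y (r , c) with column c
        ... | first  = range _ _ (cell₁ r)
        ... | second = range _ _ (cell₂ r)

        incr₁′ : ∀ x x' y → InBox (a + b) 2 x y → InBox (a + b) 2 x' y → x < x' →
                 entry x y < entry x' y
        incr₁′ x x' y (r , c) (r' , _) with column c
        ... | first  = first-< r r'
        ... | second = second-< r r'

        incr₂′ : ∀ x y y' → InBox (a + b) 2 x y → InBox (a + b) 2 x y' → y < y' →
                 entry x y < entry x y'
        incr₂′ x y y' (r , c) (_ , c') y<y' with column c | column c'
        ... | first  | second = first<second r
        ... | first  | first  = contradiction refl (<⇒≢ y<y')
        ... | second | second = contradiction refl (<⇒≢ y<y')
        ... | second | first  = contradiction y<y' (<-asym (n<1+n 1))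

        displ′ : ∀ x y x' y' → InBox (a + b) 2 x y → InBox (a + b) 2 x' y' →
                 entry x y ≡ entry x' y' → DiagCongr (m (entry x y)) x y x' y'
        displ′ x y x' y' (r , c) (r' , c') e with column c | column c'
        ... | first  | second = first≡second⇒DiagCongr r r' e
        ... | second | first  =
          subst (λ v → DiagCongr (m v) x 2 x' 1) (sym e)
                (DiagCongr-cross x' 1 x 2 x 2 x' 1 refl refl (first≡second⇒DiagCongr r' r (sym e)))
        ... | first  | first
          with refl ← strictMono⇒injective (λ x → entry x 1) first-< r r' e = DiagCongr-refl _ x 1
        ... | second | second
          with refl ← strictMono⇒injective (λ x → entry x 2) second-< r r' e = DiagCongr-refl _ x 2

  module Greedy (T : DisplacementTableau g m (suc a) (suc b)) (1≤a : 1 ≤ a) where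
    open DisplacementTableau T

    CanDescend : ℕ → ℕ → Set
    CanDescend r c = r < a × 2 ≤ c × c ≤ suc b × t r c < t (2 + r) (pred c)

    canDescend? : ∀ r c → Dec (CanDescend r c)
    canDescend? r c = r <? a ×-dec 2 ≤? c ×-dec c ≤? suc b ×-dec t r c <? t (2 + r) (pred c)

    next : ℕ × ℕ → ℕ × ℕ
    next (r , c) with canDescend? r c
    ... | yes _ = suc r , c
    ... | no _  = r , suc c

    position : ℕ → ℕ × ℕ
    position zero    = 1 , 0
    position (suc x) = next (position x)

    row col : ℕ → ℕ
    row = proj₁ ∘ position
    col = proj₂ ∘ position

    data Move (r c : ℕ) (next-position : ℕ × ℕ) : Set where
      descend : CanDescend r c → proj₁ next-position ≡ suc r → proj₂ next-position ≡ c →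
                Move r c next-position
      advance : ¬ CanDescend r c → proj₁ next-position ≡ r → proj₂ next-position ≡ suc c →
                Move r c next-position

    move-from : ∀ r c → Move r c (next (r , c))
    move-from r c with canDescend? r c
    ... | yes d = descend d refl refl
    ... | no ¬d = advance ¬d refl refl

    move : ∀ x → Move (row x) (col x) (position (suc x))
    move x = move-from (row x) (col x)

    walk : Walk
    walk = record { row = row ; col = col ; row+col = row+col ; row-step = row-step }
      where
        row+col : ∀ x → row x + col x ≡ suc x
        row+col zero = refl
        row+col (suc x) with move x
        ... | descend _ e e' = trans (cong₂ _+_ e e') (cong suc (row+col x))
        ... | advance _ e e' =
          trans (cong₂ _+_ e e') (trans (+-suc (row x) (col x)) (cong suc (row+col x)))

        row-step : ∀ x → Step (row x) (row (suc x))
        row-step x with move x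
        ... | descend _ e _ = inj₂ e
        ... | advance _ e _ = inj₁ e

    open Walk walk using (row-mono)

    row-≤ : ∀ x → row x ≤ a
    row-≤ zero = 1≤a
    row-≤ (suc x) with move x
    ... | descend (r<a , _) e _ = subst (_≤ a) (sym e) r<a
    ... | advance _ e _         = subst (_≤ a) (sym e) (row-≤ x)

    row-1 : row 1 ≡ 1
    row-1 with move 0
    ... | descend (_ , () , _) _ _
    ... | advance _ e _ = e

    col-1 : col 1 ≡ 1
    col-1 with move 0
    ... | descend (_ , () , _) _ _
    ... | advance _ _ e = e

    row-2 : row 2 ≡ 1
    row-2 with move 1
    ... | descend (_ , 2≤col , _) _ _ = contradiction (subst (2 ≤_) col-1 2≤col) 1+n≰n
    ... | advance _ e _ = trans e row-1

    path : row (a + b) ≡ a → Path a b t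
    path reached = record
      { walk = walk ; row-1 = row-1 ; row-2 = row-2 ; row-≤ = row-≤ ; row-end = reached
      ; descent = descent }
      where
        descent : ∀ x → row (suc x) ≡ suc (row x) →
                  t (row x) (col x) < t (2 + row x) (pred (col x))
        descent x e with move x
        ... | descend (_ , _ , _ , t<) _ _ = t<
        ... | advance _ e' _ = contradiction (trans (sym e) e') 1+n≢n

    advance-inequality : row x < a → col x ≡ 2 + u → 2 + u ≤ b →
                         col (suc x) ≡ suc (col x) →
                         t (2 + row x) (suc u) < t (suc (row x)) (3 + u)
    advance-inequality {x} {u} row<a col≡ 2+u≤b advanced with move x
    ... | descend _ _ e = contradiction (trans (sym e) advanced) (1+n≢n ∘ sym)
    ... | advance cannot _ _ = begin-strict
      t (2 + row x) (suc u)    ≤⟨ ≮⇒≥ (λ t< → cannot′ (row<a , s≤s (s≤s z≤n) , col≤ , t<)) ⟩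
      t (row x) (2 + u)        <⟨ entry-< T here there (n≤1+n _) (n≤1+n _) diagonal< ⟩
      t (suc (row x)) (3 + u)  ∎
      where
        open ≤-Reasoning
        cannot′ : ¬ CanDescend (row x) (2 + u)
        cannot′ = subst (λ c → ¬ CanDescend (row x) c) col≡ cannot
        col≤ : 2 + u ≤ suc b
        col≤ = m≤n⇒m≤1+n 2+u≤b
        diagonal< : row x + (2 + u) < suc (row x) + (3 + u)
        diagonal< = s≤s (+-monoʳ-≤ (row x) (n≤1+n (2 + u)))
        here : InBox (suc a) (suc b) (row x) (2 + u)
        here = (row-mono {0} {x} z≤n , m≤n⇒m≤1+n (row-≤ x)) , (s≤s z≤n , m≤n⇒m≤1+n 2+u≤b)
        there : InBox (suc a) (suc b) (suc (row x)) (3 + u)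
        there = (s≤s z≤n , s≤s (<⇒≤ row<a)) , (s≤s z≤n , s≤s 2+u≤b)

  module GreedyFailure {b₀ : ℕ} (T : DisplacementTableau g m (suc a) (suc (suc b₀)))
                       (1≤a : 1 ≤ a) (stuck : Greedy.row T 1≤a (a + suc b₀) < a) where
    open DisplacementTableau T
    open Greedy T 1≤a
    open Walk walk using (row+col; row-mono; col-mono; col-step; col-≤)

    col-beyond : a + b₀ ≤ x → 2 + b₀ ≤ col x
    col-beyond a+b₀≤x = ≤-trans (≮⇒≥ col-too-small) (col-mono a+b₀≤x)
      where
        row<a : row (a + b₀) < a
        row<a = ≤-<-trans (row-mono (+-monoʳ-≤ a (n≤1+n b₀))) stuck
        col-too-small : ¬ col (a + b₀) < 2 + b₀
        col-too-small col≤ = <-irrefl (trans (row+col (a + b₀)) (sym (+-suc a b₀)))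
                                           (+-mono-<-≤ row<a (≤-pred col≤))

    -- In the original coordinates the new path visits (col′ x , row′ x): the greedy
    -- cell at x - 1 moved by (2,-1), clamped to the box.
    row′ col′ : ℕ → ℕ
    row′ x = clamp b₀ (col (pred x))
    col′ x = suc x ∸ row′ x

    row′≤suc : ∀ x → row′ x ≤ suc x
    row′≤suc x = ≤-trans (clamp-≤-suc-pred b₀ (col (pred x)))
                         (s≤s (≤-trans (pred-mono-≤ (col-≤ (pred x))) pred[n]≤n))

    row′-step : ∀ x → Step (row′ x) (row′ (suc x))
    row′-step zero    = inj₁ refl
    row′-step (suc x) = clamp-Step b₀ (col-step x)

    walk′ : Walk
    walk′ = record
      { row = row′ ; col = col′ ; row+col = m+[n∸m]≡n ∘ row′≤suc ; row-step = row′-step }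

    descent′ : ∀ x → row′ (suc x) ≡ suc (row′ x) →
               t (col′ x) (row′ x) < t (pred (col′ x)) (2 + row′ x)
    descent′ zero ()
    descent′ (suc x) increased with clamp-increase b₀ (col-step x) increased
    ... | u , col≡ , col-suc≡ , u<b₀ =
      subst₂ (λ i j → t i j < t (pred i) (2 + j)) (sym col′≡) (sym row′≡)
             (advance-inequality {x = x} row<a col≡ (s≤s u<b₀)
                                 (trans col-suc≡ (cong suc (sym col≡))))
      where
        open ≡-Reasoning
        row′≡ : row′ (suc x) ≡ suc u
        row′≡ = cong suc (trans (cong (λ c → (c ∸ 2) ⊓ b₀) col≡) (m≤n⇒m⊓n≡m (<⇒≤ u<b₀)))
        col′≡ : col′ (suc x) ≡ 2 + row x
        col′≡ = begin
          suc (suc x) ∸ row′ (suc x)  ≡⟨ cong (suc (suc x) ∸_) row′≡ ⟩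
          suc x ∸ u                   ≡⟨ cong (_∸ u) (row+col x) ⟨
          row x + col x ∸ u           ≡⟨ cong (λ c → row x + c ∸ u) col≡ ⟩
          row x + (2 + u) ∸ u         ≡⟨ cong (_∸ u) (+-assoc (row x) 2 u) ⟨
          row x + 2 + u ∸ u           ≡⟨ m+n∸n≡m (row x + 2) u ⟩
          row x + 2                   ≡⟨ +-comm (row x) 2 ⟩
          2 + row x                   ∎
        x<a+b₀ : x < a + b₀
        x<a+b₀ = ≰⇒> λ a+b₀≤x →
          <⇒≱ u<b₀ (≤-pred (≤-pred (subst (2 + b₀ ≤_) col≡ (col-beyond a+b₀≤x))))
        row<a : row x < a
        row<a = ≤-<-trans (row-mono (≤-trans (<⇒≤ x<a+b₀) (+-monoʳ-≤ a (n≤1+n b₀)))) stuck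

    transposedPath : Path (suc b₀) a (DisplacementTableau.t (transpose T))
    transposedPath = record
      { walk = walk′ ; row-1 = refl ; row-2 = cong (clamp b₀) col-1
      ; row-≤ = clamp-≤ b₀ ∘ col ∘ pred
      ; row-end = clamp-top (col-beyond (≤-reflexive (+-comm a b₀)))
      ; descent = descent′ }

  twoColumns : ∀ a b → 1 ≤ a → 1 ≤ b →
               DisplacementTableau g m (suc a) (suc b) → DisplacementTableau g m (a + b) 2
  twoColumns {g} {m} a (suc b₀) 1≤a _ T with Greedy.row T 1≤a (a + suc b₀) ≟ a
  ... | yes reached = AlongPath.tableau T (Greedy.path T 1≤a reached)
  ... | no unreached =
    subst (λ n → DisplacementTableau g m n 2) (+-comm (suc b₀) a)
          (AlongPath.tableau (transpose T) (GreedyFailure.transposedPath T 1≤a stuck))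
    where
      stuck : Greedy.row T 1≤a (a + suc b₀) < a
      stuck = ≤∧≢⇒< (Greedy.row-≤ T 1≤a (a + suc b₀)) unreached

open TwoColumns using (twoColumns)
open import Defs
open import Data.Nat using (ℕ; _≤_; suc; z≤n; s≤s) renaming (_*_ to _*ℕ_; _+_ to _+ℕ_)
open import Data.Integer as ℤ using (ℤ; +_; -[1+_]; _+_; _-_; ∣_∣; +≤+) renaming (_≤_ to _≤ℤ_)
open import Data.Integer.Properties using (pos-*)
open import Data.Integer.Tactic.RingSolver using (solve-∀)
open import Data.Product using (∃-syntax; _×_; _,_)
open import Relation.Binary.PropositionalEquality using (_≡_; refl; cong; subst; sym; module ≡-Reasoning)

swap-+- : ∀ i j k → (i - j) + k ≡ (k - j) + i
swap-+- = solve-∀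

+2≤⇒≡+[1+n] : ∀ {z} → + 2 ≤ℤ z → ∃[ a ] z ≡ + suc a × 1 ≤ a
+2≤⇒≡+[1+n] {+ suc (suc a)} _ = suc a , refl , s≤s z≤n
+2≤⇒≡+[1+n] {+ 0}           (+≤+ ())
+2≤⇒≡+[1+n] {+ 1}           (+≤+ (s≤s ()))
+2≤⇒≡+[1+n] { -[1+ _ ]}     ()

two-column-height : ∀ e r a → e + + r ≡ + suc a → (e + + (2 *ℕ r)) - + 1 ≡ + (a +ℕ r)
two-column-height e r a e+r≡1+a = begin
  (e + + (2 *ℕ r)) - + 1     ≡⟨ cong (λ s → (e + s) - + 1) (pos-* 2 r) ⟩
  (e + + 2 ℤ.* + r) - + 1    ≡⟨ regroup e (+ r) ⟩
  ((e + + r) + + r) - + 1    ≡⟨ cong (λ s → (s + + r) - + 1) e+r≡1+a ⟩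
  (+ suc a + + r) - + 1      ≡⟨⟩
  + (a +ℕ r)                 ∎
  where
    open ≡-Reasoning
    regroup : ∀ e s → (e + + 2 ℤ.* s) - + 1 ≡ ((e + s) + s) - + 1
    regroup = solve-∀

lemma1 : (g : ℕ) → 2 ≤ g → (m : ℕ → ℕ) → TorsionProfile g m →
         (r : ℕ) → 1 ≤ r → (d : ℤ) →
         + 2 ≤ℤ (+ r - d) + + g → + g ≤ℤ d →
         DisplacementTableau g m ∣ (+ g - d) + + r ∣ (suc r) →
         DisplacementTableau g m ∣ ((+ g - d) + + (2 *ℕ r)) - + 1 ∣ 2
lemma1 g _ m _ r 1≤r d 2≤r-d+g _ T
  with +2≤⇒≡+[1+n] (subst (+ 2 ≤ℤ_) (swap-+- (+ r) d (+ g)) 2≤r-d+g)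
... | a , g-d+r≡1+a , 1≤a =
  subst (λ n → DisplacementTableau g m n 2)
        (cong ∣_∣ (sym (two-column-height (+ g - d) r a g-d+r≡1+a)))
        (twoColumns a r 1≤a 1≤r
                    (subst (λ z → DisplacementTableau g m ∣ z ∣ (suc r)) g-d+r≡1+a T))
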